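{- Let $\alpha$ and $\beta$ be compositions of $n$ such that $\beta$ refines $\alpha$. Then \[ \beta!\, M\!\left(\begin{bmatrix} n \\ \beta\end{bmatrix}_q\right) \leq \alpha!\, M\!\left(\begin{bmatrix} n \\ \alpha\end{bmatrix}_q\right). \]
   Context: A composition of $n$ is a sequence $\alpha=(\alpha_1,\ldots,\alpha_m)$ of positive integers summing to $n$, and $\alpha! := \prod_i \alpha_i!$. $\beta$ refines $\alpha$ if $\beta$ can be obtained from $\alpha$ by a finite sequence (possibly empty) of operations $\gamma \mapsto (\gamma_1,\ldots,\gamma_{i-1},\gamma_i-p,p,\gamma_{i+1},\ldots,\gamma_m)$ with $0<p<\gamma_i$. The $q$-multinomial coefficient is $\begin{bmatrix} n \\ \alpha\end{bmatrix}_q = \frac{[n]_q!}{[\alpha_1]_q!\cdots[\alpha_m]_q!}$ with $[n]_q = 1+q+\cdots+q^{n-1}$, $[n]_q! = [1]_q\cdots[n]_q$. For a polynomial $f$, $M(f)$ denotes its largest coefficient. -}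

module Defs where

open import Data.Nat using (ℕ; zero; suc; _+_; _*_; _∸_; _<_; _⊔_; _!)
open import Data.Nat.ListAction using (sum)
open import Data.List using (List; []; _∷_; foldr; map; replicate)
open import Data.List.Membership.Propositional using (_∈_)
open import Data.Product using (_×_; Σ)
open import Relation.Binary.PropositionalEquality using (_≡_)

-- Polynomials with natural-number coefficients: coefficient lists,
-- constant term first. Trailing zeros are allowed; equality of
-- polynomials is equality of all coefficients (_≈ₚ_).
Poly : Set
Poly = List ℕ

coeff : Poly → ℕ → ℕ
coeff []       _       = 0
coeff (a ∷ p) zero    = a
coeff (a ∷ p) (suc k) = coeff p k

_≈ₚ_ : Poly → Poly → Set
p ≈ₚ r = ∀ k → coeff p k ≡ coeff r k

infixl 6 _+ₚ_
infixl 7 _*ₚ_ _·ₚ_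

_+ₚ_ : Poly → Poly → Poly
[]      +ₚ r       = r
(a ∷ p) +ₚ []      = a ∷ p
(a ∷ p) +ₚ (b ∷ r) = (a + b) ∷ (p +ₚ r)

_·ₚ_ : ℕ → Poly → Poly
c ·ₚ p = map (c *_) p

_*ₚ_ : Poly → Poly → Poly
[]      *ₚ r = []
(a ∷ p) *ₚ r = (a ·ₚ r) +ₚ (0 ∷ (p *ₚ r))

maxCoeff : Poly → ℕ
maxCoeff = foldr _⊔_ 0

qInt : ℕ → Poly
qInt n = replicate n 1

qFact : ℕ → Poly
qFact zero    = 1 ∷ []
qFact (suc n) = qInt (suc n) *ₚ qFact n

Composition : ℕ → Set
Composition n = Σ (List ℕ) (λ α → (∀ {x} → x ∈ α → 0 < x) × sum α ≡ n)

compFact : List ℕ → ℕ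
compFact = foldr (λ a r → (a !) * r) 1

qCompFact : List ℕ → Poly
qCompFact = foldr (λ a r → qFact a *ₚ r) (1 ∷ [])

-- P is the q-multinomial coefficient [n; α]_q, i.e. P · ∏[α_i]_q! = [n]_q!
-- (the product ∏[α_i]_q! is nonzero, so P is uniquely determined).
IsQMultinomial : ℕ → List ℕ → Poly → Set
IsQMultinomial n α P = (P *ₚ qCompFact α) ≈ₚ qFact n

data SplitStep : List ℕ → List ℕ → Set where
  here  : ∀ {g p γ} → 0 < p → p < g → SplitStep (g ∷ γ) ((g ∸ p) ∷ p ∷ γ)
  there : ∀ {g γ δ} → SplitStep γ δ → SplitStep (g ∷ γ) (g ∷ δ)

data Refines : List ℕ → List ℕ → Set where
  refl-ref : ∀ {α} → Refines α α
  step-ref : ∀ {α γ β} → SplitStep α γ → Refines β γ → Refines β α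

module Submission where

-- Splitting a part g of α into g − p and p multiplies ∏[β_i]_q! by the Gaussian
-- binomial [g; p]_q, so along a refinement ∏[α_i]_q! = Q · ∏[β_i]_q! for a
-- polynomial Q with nonnegative coefficients. Cancelling ∏[β_i]_q! (its constant
-- term is 1) gives [n; β]_q = Q · [n; α]_q, hence M([n; β]_q) ≤ Q(1) · M([n; α]_q),
-- and evaluating the factorisation at q = 1 gives Q(1) = α! / β!.

open import Defs
open import Algebra.Bundles using (CommutativeSemigroup)
import Algebra.Properties.CommutativeSemigroup as CommSemigroupProperties
open import Data.Nat using (ℕ; zero; suc; _+_; _*_; _∸_; _≤_; _<_; _!; z≤n; >-nonZero)
open import Data.Nat.ListAction using (sum)
open import Data.Nat.Properties
open import Data.List using ([]; _∷_; drop)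
open import Data.Product using (Σ; _,_; proj₁)
open import Relation.Binary.Bundles using (Setoid)
open import Relation.Binary.PropositionalEquality
  using (_≡_; refl; sym; trans; cong; cong₂; module ≡-Reasoning)
import Relation.Binary.Reasoning.Setoid as SetoidReasoning

open CommSemigroupProperties +-commutativeSemigroup
  using () renaming (interchange to +-interchange; x∙yz≈y∙xz to +-leftComm)

coeff-+ₚ : ∀ p r k → coeff (p +ₚ r) k ≡ coeff p k + coeff r k
coeff-+ₚ []      r       k       = refl
coeff-+ₚ (a ∷ p) []      zero    = sym (+-identityʳ a)
coeff-+ₚ (a ∷ p) []      (suc k) = sym (+-identityʳ _)
coeff-+ₚ (a ∷ p) (b ∷ r) zero    = refl
coeff-+ₚ (a ∷ p) (b ∷ r) (suc k) = coeff-+ₚ p r k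

coeff-·ₚ : ∀ c p k → coeff (c ·ₚ p) k ≡ c * coeff p k
coeff-·ₚ c []      k       = sym (*-zeroʳ c)
coeff-·ₚ c (a ∷ p) zero    = refl
coeff-·ₚ c (a ∷ p) (suc k) = coeff-·ₚ c p k

coeff-drop : ∀ p k → coeff (drop 1 p) k ≡ coeff p (suc k)
coeff-drop []      k = refl
coeff-drop (a ∷ p) k = refl

coeff-*ₚ-zero : ∀ p r → coeff (p *ₚ r) 0 ≡ coeff p 0 * coeff r 0
coeff-*ₚ-zero []      r = refl
coeff-*ₚ-zero (a ∷ p) r =
  trans (coeff-+ₚ (a ·ₚ r) _ 0) (trans (+-identityʳ _) (coeff-·ₚ a r 0))

coeff-*ₚ-suc : ∀ p r k →
  coeff (p *ₚ r) (suc k) ≡ coeff p 0 * coeff r (suc k) + coeff (drop 1 p *ₚ r) k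
coeff-*ₚ-suc []      r k = refl
coeff-*ₚ-suc (a ∷ p) r k =
  trans (coeff-+ₚ (a ·ₚ r) _ (suc k)) (cong (_+ _) (coeff-·ₚ a r (suc k)))

-- _≈ₚ_ wrapped in a record, so that both polynomials can be inferred from a proof.
infix 4 _≃_
record _≃_ (p r : Poly) : Set where
  constructor mk≃
  field coeff-≡ : p ≈ₚ r
open _≃_

≃-refl : ∀ {p} → p ≃ p
≃-refl = mk≃ λ _ → refl

≃-sym : ∀ {p r} → p ≃ r → r ≃ p
≃-sym e = mk≃ λ k → sym (coeff-≡ e k)

≃-trans : ∀ {p r s} → p ≃ r → r ≃ s → p ≃ s
≃-trans e f = mk≃ λ k → trans (coeff-≡ e k) (coeff-≡ f k)

≃-setoid : Setoid _ _
≃-setoid = record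
  { Carrier = Poly ; _≈_ = _≃_
  ; isEquivalence = record { refl = ≃-refl ; sym = ≃-sym ; trans = ≃-trans } }

module ≃-Reasoning = SetoidReasoning ≃-setoid

∷-cong : ∀ {a b p r} → a ≡ b → p ≃ r → (a ∷ p) ≃ (b ∷ r)
∷-cong a≡b e = mk≃ λ { zero → a≡b ; (suc k) → coeff-≡ e k }

0∷[]≃[] : (0 ∷ []) ≃ []
0∷[]≃[] = mk≃ λ { zero → refl ; (suc k) → refl }

drop-cong : ∀ {p r} → p ≃ r → drop 1 p ≃ drop 1 r
drop-cong {p} {r} e = mk≃ λ k →
  trans (coeff-drop p k) (trans (coeff-≡ e (suc k)) (sym (coeff-drop r k)))

+ₚ-cong : ∀ {p p′ r r′} → p ≃ p′ → r ≃ r′ → (p +ₚ r) ≃ (p′ +ₚ r′)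
+ₚ-cong {p} {p′} {r} {r′} e f = mk≃ λ k →
  trans (coeff-+ₚ p r k)
    (trans (cong₂ _+_ (coeff-≡ e k) (coeff-≡ f k)) (sym (coeff-+ₚ p′ r′ k)))

+ₚ-identityʳ : ∀ p → (p +ₚ []) ≃ p
+ₚ-identityʳ p = mk≃ λ k → trans (coeff-+ₚ p [] k) (+-identityʳ _)

+ₚ-interchange : ∀ w x y z → ((w +ₚ x) +ₚ (y +ₚ z)) ≃ ((w +ₚ y) +ₚ (x +ₚ z))
+ₚ-interchange w x y z = mk≃ λ k → begin
  coeff ((w +ₚ x) +ₚ (y +ₚ z)) k
    ≡⟨ trans (coeff-+ₚ (w +ₚ x) _ k) (cong₂ _+_ (coeff-+ₚ w x k) (coeff-+ₚ y z k)) ⟩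
  (coeff w k + coeff x k) + (coeff y k + coeff z k)
    ≡⟨ +-interchange (coeff w k) (coeff x k) (coeff y k) (coeff z k) ⟩
  (coeff w k + coeff y k) + (coeff x k + coeff z k)
    ≡⟨ sym (trans (coeff-+ₚ (w +ₚ y) _ k) (cong₂ _+_ (coeff-+ₚ w y k) (coeff-+ₚ x z k))) ⟩
  coeff ((w +ₚ y) +ₚ (x +ₚ z)) k ∎
  where open ≡-Reasoning

+ₚ-leftComm : ∀ x y z → (x +ₚ (y +ₚ z)) ≃ (y +ₚ (x +ₚ z))
+ₚ-leftComm x y z = mk≃ λ k → begin
  coeff (x +ₚ (y +ₚ z)) k
    ≡⟨ trans (coeff-+ₚ x _ k) (cong (coeff x k +_) (coeff-+ₚ y z k)) ⟩
  coeff x k + (coeff y k + coeff z k)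
    ≡⟨ +-leftComm (coeff x k) (coeff y k) (coeff z k) ⟩
  coeff y k + (coeff x k + coeff z k)
    ≡⟨ sym (trans (coeff-+ₚ y _ k) (cong (coeff y k +_) (coeff-+ₚ x z k))) ⟩
  coeff (y +ₚ (x +ₚ z)) k ∎
  where open ≡-Reasoning

·ₚ-congʳ : ∀ c {p r} → p ≃ r → (c ·ₚ p) ≃ (c ·ₚ r)
·ₚ-congʳ c {p} {r} e = mk≃ λ k →
  trans (coeff-·ₚ c p k) (trans (cong (c *_) (coeff-≡ e k)) (sym (coeff-·ₚ c r k)))

·ₚ-distribʳ-+ : ∀ a b s → ((a + b) ·ₚ s) ≃ ((a ·ₚ s) +ₚ (b ·ₚ s))
·ₚ-distribʳ-+ a b s = mk≃ λ k →
  trans (coeff-·ₚ (a + b) s k) (trans (*-distribʳ-+ (coeff s k) a b)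
    (sym (trans (coeff-+ₚ (a ·ₚ s) _ k) (cong₂ _+_ (coeff-·ₚ a s k) (coeff-·ₚ b s k)))))

·ₚ-distribˡ-+ₚ : ∀ c r s → (c ·ₚ (r +ₚ s)) ≃ ((c ·ₚ r) +ₚ (c ·ₚ s))
·ₚ-distribˡ-+ₚ c r s = mk≃ λ k →
  trans (coeff-·ₚ c (r +ₚ s) k) (trans (cong (c *_) (coeff-+ₚ r s k))
    (trans (*-distribˡ-+ c (coeff r k) _)
      (sym (trans (coeff-+ₚ (c ·ₚ r) _ k) (cong₂ _+_ (coeff-·ₚ c r k) (coeff-·ₚ c s k))))))

·ₚ-assoc : ∀ c a r → ((c * a) ·ₚ r) ≃ (c ·ₚ (a ·ₚ r))
·ₚ-assoc c a r = mk≃ λ k →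
  trans (coeff-·ₚ (c * a) r k) (trans (*-assoc c a _)
    (sym (trans (coeff-·ₚ c (a ·ₚ r) k) (cong (c *_) (coeff-·ₚ a r k)))))

*ₚ-congˡ : ∀ r {p p′} → p ≃ p′ → (p *ₚ r) ≃ (p′ *ₚ r)
*ₚ-congˡ r e = mk≃ (coeffs e)
  where
  coeffs : ∀ {p p′} → p ≃ p′ → ∀ k → coeff (p *ₚ r) k ≡ coeff (p′ *ₚ r) k
  coeffs {p} {p′} e zero = trans (coeff-*ₚ-zero p r)
    (trans (cong (_* coeff r 0) (coeff-≡ e 0)) (sym (coeff-*ₚ-zero p′ r)))
  coeffs {p} {p′} e (suc k) = trans (coeff-*ₚ-suc p r k)
    (trans (cong₂ _+_ (cong (_* coeff r (suc k)) (coeff-≡ e 0)) (coeffs (drop-cong e) k))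
      (sym (coeff-*ₚ-suc p′ r k)))

*ₚ-congʳ : ∀ p {r r′} → r ≃ r′ → (p *ₚ r) ≃ (p *ₚ r′)
*ₚ-congʳ []      e = ≃-refl
*ₚ-congʳ (a ∷ p) e = +ₚ-cong (·ₚ-congʳ a e) (∷-cong refl (*ₚ-congʳ p e))

*ₚ-distribʳ-+ₚ : ∀ p r s → ((p +ₚ r) *ₚ s) ≃ ((p *ₚ s) +ₚ (r *ₚ s))
*ₚ-distribʳ-+ₚ []      r       s = ≃-refl
*ₚ-distribʳ-+ₚ (a ∷ p) []      s = ≃-sym (+ₚ-identityʳ _)
*ₚ-distribʳ-+ₚ (a ∷ p) (b ∷ r) s = begin
  ((a + b) ·ₚ s) +ₚ (0 ∷ ((p +ₚ r) *ₚ s))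
    ≈⟨ +ₚ-cong (·ₚ-distribʳ-+ a b s) (∷-cong refl (*ₚ-distribʳ-+ₚ p r s)) ⟩
  ((a ·ₚ s) +ₚ (b ·ₚ s)) +ₚ ((0 ∷ (p *ₚ s)) +ₚ (0 ∷ (r *ₚ s)))
    ≈⟨ +ₚ-interchange (a ·ₚ s) _ _ _ ⟩
  ((a ·ₚ s) +ₚ (0 ∷ (p *ₚ s))) +ₚ ((b ·ₚ s) +ₚ (0 ∷ (r *ₚ s))) ∎
  where open ≃-Reasoning

·ₚ-*ₚ-assoc : ∀ c p r → ((c ·ₚ p) *ₚ r) ≃ (c ·ₚ (p *ₚ r))
·ₚ-*ₚ-assoc c []      r = ≃-refl
·ₚ-*ₚ-assoc c (a ∷ p) r = begin
  ((c * a) ·ₚ r) +ₚ (0 ∷ ((c ·ₚ p) *ₚ r))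
    ≈⟨ +ₚ-cong (·ₚ-assoc c a r) (∷-cong (sym (*-zeroʳ c)) (·ₚ-*ₚ-assoc c p r)) ⟩
  (c ·ₚ (a ·ₚ r)) +ₚ (c ·ₚ (0 ∷ (p *ₚ r)))
    ≈⟨ ≃-sym (·ₚ-distribˡ-+ₚ c (a ·ₚ r) _) ⟩
  c ·ₚ ((a ·ₚ r) +ₚ (0 ∷ (p *ₚ r))) ∎
  where open ≃-Reasoning

0∷-*ₚ : ∀ p r → ((0 ∷ p) *ₚ r) ≃ (0 ∷ (p *ₚ r))
0∷-*ₚ p r = mk≃ λ k →
  trans (coeff-+ₚ (0 ·ₚ r) _ k) (cong (_+ coeff (0 ∷ (p *ₚ r)) k) (coeff-·ₚ 0 r k))

*ₚ-assoc : ∀ p r s → ((p *ₚ r) *ₚ s) ≃ (p *ₚ (r *ₚ s))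
*ₚ-assoc []      r s = ≃-refl
*ₚ-assoc (a ∷ p) r s = begin
  ((a ·ₚ r) +ₚ (0 ∷ (p *ₚ r))) *ₚ s
    ≈⟨ *ₚ-distribʳ-+ₚ (a ·ₚ r) _ s ⟩
  ((a ·ₚ r) *ₚ s) +ₚ ((0 ∷ (p *ₚ r)) *ₚ s)
    ≈⟨ +ₚ-cong (·ₚ-*ₚ-assoc a r s) (≃-trans (0∷-*ₚ (p *ₚ r) s) (∷-cong refl (*ₚ-assoc p r s))) ⟩
  (a ·ₚ (r *ₚ s)) +ₚ (0 ∷ (p *ₚ (r *ₚ s))) ∎
  where open ≃-Reasoning

*ₚ-∷ʳ : ∀ p b r → (p *ₚ (b ∷ r)) ≃ ((b ·ₚ p) +ₚ (0 ∷ (p *ₚ r)))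
*ₚ-∷ʳ []      b r = ≃-sym 0∷[]≃[]
*ₚ-∷ʳ (a ∷ p) b r = ∷-cong (cong (_+ 0) (*-comm a b))
  (≃-trans (+ₚ-cong ≃-refl (*ₚ-∷ʳ p b r)) (+ₚ-leftComm (a ·ₚ r) (b ·ₚ p) _))

*ₚ-zeroʳ : ∀ p → (p *ₚ []) ≃ []
*ₚ-zeroʳ []      = ≃-refl
*ₚ-zeroʳ (a ∷ p) = ≃-trans (∷-cong refl (*ₚ-zeroʳ p)) 0∷[]≃[]

*ₚ-comm : ∀ p r → (p *ₚ r) ≃ (r *ₚ p)
*ₚ-comm []      r = ≃-sym (*ₚ-zeroʳ r)
*ₚ-comm (a ∷ p) r =
  ≃-trans (+ₚ-cong ≃-refl (∷-cong refl (*ₚ-comm p r))) (≃-sym (*ₚ-∷ʳ r a p))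

*ₚ-identityˡ : ∀ p → ((1 ∷ []) *ₚ p) ≃ p
*ₚ-identityˡ p = mk≃ λ k → trans (coeff-+ₚ (1 ·ₚ p) _ k)
  (trans (cong₂ _+_ (coeff-·ₚ 1 p k) (coeff-≡ 0∷[]≃[] k)) (trans (+-identityʳ _) (*-identityˡ _)))

*ₚ-commutativeSemigroup : CommutativeSemigroup _ _
*ₚ-commutativeSemigroup = record
  { Carrier = Poly ; _≈_ = _≃_ ; _∙_ = _*ₚ_
  ; isCommutativeSemigroup = record
    { isSemigroup = record
      { isMagma = record
        { isEquivalence = Setoid.isEquivalence ≃-setoid
        ; ∙-cong = λ {_} {p′} {r} e f → ≃-trans (*ₚ-congˡ r e) (*ₚ-congʳ p′ f) }
      ; assoc = *ₚ-assoc }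
    ; comm = *ₚ-comm } }

open CommSemigroupProperties *ₚ-commutativeSemigroup using (x∙yz≈y∙xz; x∙yz≈yx∙z)

*ₚ-cancelʳ : ∀ c → 0 < coeff c 0 → ∀ p r → (p *ₚ c) ≃ (r *ₚ c) → p ≃ r
*ₚ-cancelʳ c c₀>0 p r e = mk≃ λ k → coeffs k p r e
  where
  head : ∀ p r → (p *ₚ c) ≃ (r *ₚ c) → coeff p 0 ≡ coeff r 0
  head p r e = *-cancelʳ-≡ _ _ (coeff c 0) {{>-nonZero c₀>0}}
    (trans (sym (coeff-*ₚ-zero p c)) (trans (coeff-≡ e 0) (coeff-*ₚ-zero r c)))

  tail : ∀ p r → (p *ₚ c) ≃ (r *ₚ c) → (drop 1 p *ₚ c) ≃ (drop 1 r *ₚ c)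
  tail p r e = mk≃ λ k → +-cancelˡ-≡ (coeff r 0 * coeff c (suc k)) _ _
    (trans (cong (λ x → x * coeff c (suc k) + coeff (drop 1 p *ₚ c) k) (sym (head p r e)))
      (trans (sym (coeff-*ₚ-suc p c k)) (trans (coeff-≡ e (suc k)) (coeff-*ₚ-suc r c k))))

  coeffs : ∀ k p r → (p *ₚ c) ≃ (r *ₚ c) → coeff p k ≡ coeff r k
  coeffs zero    p r e = head p r e
  coeffs (suc k) p r e = trans (sym (coeff-drop p k))
    (trans (coeffs k (drop 1 p) (drop 1 r) (tail p r e)) (coeff-drop r k))

sum-+ₚ : ∀ p r → sum (p +ₚ r) ≡ sum p + sum r
sum-+ₚ []      r       = refl
sum-+ₚ (a ∷ p) []      = sym (+-identityʳ _)
sum-+ₚ (a ∷ p) (b ∷ r) =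
  trans (cong ((a + b) +_) (sum-+ₚ p r)) (+-interchange a b (sum p) (sum r))

sum-·ₚ : ∀ c p → sum (c ·ₚ p) ≡ c * sum p
sum-·ₚ c []      = sym (*-zeroʳ c)
sum-·ₚ c (a ∷ p) = trans (cong (c * a +_) (sum-·ₚ c p)) (sym (*-distribˡ-+ c a _))

sum-*ₚ : ∀ p r → sum (p *ₚ r) ≡ sum p * sum r
sum-*ₚ []      r = refl
sum-*ₚ (a ∷ p) r = trans (sum-+ₚ (a ·ₚ r) _)
  (trans (cong₂ _+_ (sum-·ₚ a r) (sum-*ₚ p r)) (sym (*-distribʳ-+ (sum r) a _)))

sum-drop : ∀ p → sum p ≡ coeff p 0 + sum (drop 1 p)
sum-drop []      = refl
sum-drop (a ∷ p) = refl

sum-resp-≃ : ∀ p r → p ≃ r → sum p ≡ sum r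
sum-resp-≃ []      []      e = refl
sum-resp-≃ []      (b ∷ r) e = cong₂ _+_ (coeff-≡ e 0) (sum-resp-≃ [] r (drop-cong e))
sum-resp-≃ (a ∷ p) r       e =
  trans (cong₂ _+_ (coeff-≡ e 0) (sum-resp-≃ p (drop 1 r) (drop-cong e))) (sym (sum-drop r))

coeff≤maxCoeff : ∀ p k → coeff p k ≤ maxCoeff p
coeff≤maxCoeff []      k       = z≤n
coeff≤maxCoeff (a ∷ p) zero    = m≤m⊔n a _
coeff≤maxCoeff (a ∷ p) (suc k) = ≤-trans (coeff≤maxCoeff p k) (m≤n⊔m a _)

maxCoeff-lub : ∀ p {m} → (∀ k → coeff p k ≤ m) → maxCoeff p ≤ m
maxCoeff-lub []      h = z≤n
maxCoeff-lub (a ∷ p) h = ⊔-lub (h 0) (maxCoeff-lub p (λ k → h (suc k)))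

maxCoeff-resp-≃ : ∀ {p r} → p ≃ r → maxCoeff p ≡ maxCoeff r
maxCoeff-resp-≃ {p} {r} e = ≤-antisym
  (maxCoeff-lub p λ k → ≤-trans (≤-reflexive (coeff-≡ e k)) (coeff≤maxCoeff r k))
  (maxCoeff-lub r λ k → ≤-trans (≤-reflexive (sym (coeff-≡ e k))) (coeff≤maxCoeff p k))

coeff-*ₚ-≤ : ∀ q p k → coeff (q *ₚ p) k ≤ sum q * maxCoeff p
coeff-*ₚ-≤ []      p k = z≤n
coeff-*ₚ-≤ (b ∷ q) p k = begin
  coeff ((b ·ₚ p) +ₚ (0 ∷ (q *ₚ p))) k
    ≡⟨ trans (coeff-+ₚ (b ·ₚ p) _ k) (cong (_+ _) (coeff-·ₚ b p k)) ⟩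
  b * coeff p k + coeff (0 ∷ (q *ₚ p)) k
    ≤⟨ +-mono-≤ (*-monoʳ-≤ b (coeff≤maxCoeff p k)) (coeff-0∷ k) ⟩
  b * maxCoeff p + sum q * maxCoeff p
    ≡⟨ sym (*-distribʳ-+ (maxCoeff p) b _) ⟩
  (b + sum q) * maxCoeff p ∎
  where
  open ≤-Reasoning
  coeff-0∷ : ∀ k → coeff (0 ∷ (q *ₚ p)) k ≤ sum q * maxCoeff p
  coeff-0∷ zero    = z≤n
  coeff-0∷ (suc k) = coeff-*ₚ-≤ q p k

maxCoeff-*ₚ-≤ : ∀ q p → maxCoeff (q *ₚ p) ≤ sum q * maxCoeff p
maxCoeff-*ₚ-≤ q p = maxCoeff-lub (q *ₚ p) (coeff-*ₚ-≤ q p)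

shiftₚ : ℕ → Poly → Poly
shiftₚ zero    p = p
shiftₚ (suc m) p = 0 ∷ shiftₚ m p

shiftₚ-cong : ∀ m {p r} → p ≃ r → shiftₚ m p ≃ shiftₚ m r
shiftₚ-cong zero    e = e
shiftₚ-cong (suc m) e = ∷-cong refl (shiftₚ-cong m e)

shiftₚ-*ₚ : ∀ m p r → (shiftₚ m p *ₚ r) ≃ shiftₚ m (p *ₚ r)
shiftₚ-*ₚ zero    p r = ≃-refl
shiftₚ-*ₚ (suc m) p r = ≃-trans (0∷-*ₚ (shiftₚ m p) r) (∷-cong refl (shiftₚ-*ₚ m p r))

qInt-+ : ∀ m n → qInt (m + n) ≃ (qInt m +ₚ shiftₚ m (qInt n))
qInt-+ zero    n = ≃-refl
qInt-+ (suc m) n = ∷-cong refl (qInt-+ m n)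

-- qBinomial a b is the Gaussian binomial [a + b; a]_q, built by the q-Pascal rule.
qBinomial : ℕ → ℕ → Poly
qBinomial zero    b       = 1 ∷ []
qBinomial (suc a) zero    = 1 ∷ []
qBinomial (suc a) (suc b) = qBinomial a (suc b) +ₚ shiftₚ (suc a) (qBinomial (suc a) b)

qFact-cong : ∀ {m n} → m ≡ n → qFact m ≃ qFact n
qFact-cong refl = ≃-refl

qFact-+ : ∀ a b → qFact (a + b) ≃ (qBinomial a b *ₚ (qFact a *ₚ qFact b))
qFact-+ zero    b    = ≃-sym (≃-trans (*ₚ-identityˡ _) (*ₚ-identityˡ _))
qFact-+ (suc a) zero = ≃-trans (qFact-cong (+-identityʳ (suc a)))
  (≃-sym (≃-trans (*ₚ-identityˡ _) (≃-trans (*ₚ-comm (qFact (suc a)) _) (*ₚ-identityˡ _))))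
qFact-+ (suc a) (suc b) = begin
  qInt (suc a + suc b) *ₚ F
    ≈⟨ *ₚ-congˡ F (qInt-+ (suc a) (suc b)) ⟩
  (I +ₚ shiftₚ (suc a) J) *ₚ F
    ≈⟨ *ₚ-distribʳ-+ₚ I (shiftₚ (suc a) J) F ⟩
  (I *ₚ F) +ₚ (shiftₚ (suc a) J *ₚ F)
    ≈⟨ +ₚ-cong ≃-refl (shiftₚ-*ₚ (suc a) J F) ⟩
  (I *ₚ F) +ₚ shiftₚ (suc a) (J *ₚ F)
    ≈⟨ +ₚ-cong (*ₚ-congʳ I (qFact-+ a (suc b))) (shiftₚ-cong (suc a) (*ₚ-congʳ J F≃)) ⟩
  (I *ₚ (B₁ *ₚ (Fa *ₚ (J *ₚ Fb)))) +ₚ shiftₚ (suc a) (J *ₚ (B₂ *ₚ ((I *ₚ Fa) *ₚ Fb)))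
    ≈⟨ +ₚ-cong (≃-trans (x∙yz≈y∙xz I B₁ _) (*ₚ-congʳ B₁ (≃-sym (*ₚ-assoc I Fa _))))
         (shiftₚ-cong (suc a) (≃-trans (x∙yz≈y∙xz J B₂ _) (*ₚ-congʳ B₂ (x∙yz≈y∙xz J (I *ₚ Fa) Fb)))) ⟩
  (B₁ *ₚ G) +ₚ shiftₚ (suc a) (B₂ *ₚ G)
    ≈⟨ +ₚ-cong ≃-refl (≃-sym (shiftₚ-*ₚ (suc a) B₂ G)) ⟩
  (B₁ *ₚ G) +ₚ (shiftₚ (suc a) B₂ *ₚ G)
    ≈⟨ ≃-sym (*ₚ-distribʳ-+ₚ B₁ (shiftₚ (suc a) B₂) G) ⟩
  (B₁ +ₚ shiftₚ (suc a) B₂) *ₚ G ∎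
  where
  open ≃-Reasoning
  F  = qFact (a + suc b)
  I  = qInt (suc a)
  J  = qInt (suc b)
  Fa = qFact a
  Fb = qFact b
  B₁ = qBinomial a (suc b)
  B₂ = qBinomial (suc a) b
  G  = (I *ₚ Fa) *ₚ (J *ₚ Fb)
  F≃ : F ≃ (B₂ *ₚ ((I *ₚ Fa) *ₚ Fb))
  F≃ = ≃-trans (qFact-cong (+-suc a b)) (qFact-+ (suc a) b)

coeff-qFact-zero : ∀ n → coeff (qFact n) 0 ≡ 1
coeff-qFact-zero zero    = refl
coeff-qFact-zero (suc n) =
  trans (coeff-*ₚ-zero (qInt (suc n)) (qFact n)) (cong (1 *_) (coeff-qFact-zero n))

coeff-qCompFact-zero : ∀ α → coeff (qCompFact α) 0 ≡ 1
coeff-qCompFact-zero []      = refl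
coeff-qCompFact-zero (a ∷ α) = trans (coeff-*ₚ-zero (qFact a) (qCompFact α))
  (cong₂ _*_ (coeff-qFact-zero a) (coeff-qCompFact-zero α))

sum-qInt : ∀ n → sum (qInt n) ≡ n
sum-qInt zero    = refl
sum-qInt (suc n) = cong suc (sum-qInt n)

sum-qFact : ∀ n → sum (qFact n) ≡ n !
sum-qFact zero    = refl
sum-qFact (suc n) = trans (sum-*ₚ (qInt (suc n)) (qFact n))
  (cong₂ _*_ (sum-qInt (suc n)) (sum-qFact n))

sum-qCompFact : ∀ α → sum (qCompFact α) ≡ compFact α
sum-qCompFact []      = refl
sum-qCompFact (a ∷ α) =
  trans (sum-*ₚ (qFact a) (qCompFact α)) (cong₂ _*_ (sum-qFact a) (sum-qCompFact α))

infix 4 _∣ₚ_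
_∣ₚ_ : Poly → Poly → Set
d ∣ₚ p = Σ Poly λ q → p ≃ (q *ₚ d)

∣ₚ-refl : ∀ {p} → p ∣ₚ p
∣ₚ-refl = (1 ∷ []) , ≃-sym (*ₚ-identityˡ _)

∣ₚ-trans : ∀ {d p s} → d ∣ₚ p → p ∣ₚ s → d ∣ₚ s
∣ₚ-trans {d} (q , p≃qd) (r , s≃rp) =
  (r *ₚ q) , ≃-trans s≃rp (≃-trans (*ₚ-congʳ r p≃qd) (≃-sym (*ₚ-assoc r q d)))

qCompFact-∣ₚ-splitStep : ∀ {α γ} → SplitStep α γ → qCompFact γ ∣ₚ qCompFact α
qCompFact-∣ₚ-splitStep (here {g} {p} {γ} _ p<g) = B , (begin
  qFact g *ₚ X
    ≈⟨ *ₚ-congˡ X (qFact-cong (sym (m∸n+n≡m (<⇒≤ p<g)))) ⟩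
  qFact (g ∸ p + p) *ₚ X
    ≈⟨ *ₚ-congˡ X (qFact-+ (g ∸ p) p) ⟩
  (B *ₚ (qFact (g ∸ p) *ₚ qFact p)) *ₚ X
    ≈⟨ *ₚ-assoc B _ X ⟩
  B *ₚ ((qFact (g ∸ p) *ₚ qFact p) *ₚ X)
    ≈⟨ *ₚ-congʳ B (*ₚ-assoc (qFact (g ∸ p)) (qFact p) X) ⟩
  B *ₚ (qFact (g ∸ p) *ₚ (qFact p *ₚ X)) ∎)
  where
  open ≃-Reasoning
  B = qBinomial (g ∸ p) p
  X = qCompFact γ
qCompFact-∣ₚ-splitStep (there {g} s) with qCompFact-∣ₚ-splitStep s
... | q , e = q , ≃-trans (*ₚ-congʳ (qFact g) e) (x∙yz≈y∙xz (qFact g) q _)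

qCompFact-∣ₚ-refines : ∀ {β α} → Refines β α → qCompFact β ∣ₚ qCompFact α
qCompFact-∣ₚ-refines refl-ref       = ∣ₚ-refl
qCompFact-∣ₚ-refines (step-ref s r) =
  ∣ₚ-trans (qCompFact-∣ₚ-refines r) (qCompFact-∣ₚ-splitStep s)

compFact-quotient : ∀ α β q → qCompFact α ≃ (q *ₚ qCompFact β) →
  sum q * compFact β ≡ compFact α
compFact-quotient α β q e = begin
  sum q * compFact β               ≡⟨ cong (sum q *_) (sym (sum-qCompFact β)) ⟩
  sum q * sum (qCompFact β)        ≡⟨ sym (sum-*ₚ q (qCompFact β)) ⟩
  sum (q *ₚ qCompFact β)           ≡⟨ sym (sum-resp-≃ _ _ e) ⟩
  sum (qCompFact α)                ≡⟨ sum-qCompFact α ⟩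
  compFact α ∎
  where open ≡-Reasoning

qMultinomial-quotient : ∀ n α β Pα Pβ q →
  IsQMultinomial n α Pα → IsQMultinomial n β Pβ →
  qCompFact α ≃ (q *ₚ qCompFact β) → Pβ ≃ (q *ₚ Pα)
qMultinomial-quotient n α β Pα Pβ q hα hβ e =
  *ₚ-cancelʳ X (≤-reflexive (sym (coeff-qCompFact-zero β))) Pβ (q *ₚ Pα) (begin
    Pβ *ₚ X              ≈⟨ mk≃ hβ ⟩
    qFact n              ≈⟨ ≃-sym (mk≃ hα) ⟩
    Pα *ₚ qCompFact α    ≈⟨ *ₚ-congʳ Pα e ⟩
    Pα *ₚ (q *ₚ X)       ≈⟨ x∙yz≈yx∙z Pα q X ⟩
    (q *ₚ Pα) *ₚ X ∎)
  where
  open ≃-Reasoning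
  X = qCompFact β

lemma2p3 : (n : ℕ) (α β : Composition n) → Refines (proj₁ β) (proj₁ α) →
    (Pα Pβ : Poly) → IsQMultinomial n (proj₁ α) Pα → IsQMultinomial n (proj₁ β) Pβ →
    compFact (proj₁ β) * maxCoeff Pβ ≤ compFact (proj₁ α) * maxCoeff Pα
lemma2p3 n (α , _) (β , _) β⊑α Pα Pβ hα hβ with qCompFact-∣ₚ-refines β⊑α
... | q , α≃qβ = begin
  compFact β * maxCoeff Pβ            ≡⟨ cong (compFact β *_) (maxCoeff-resp-≃ Pβ≃qPα) ⟩
  compFact β * maxCoeff (q *ₚ Pα)     ≤⟨ *-monoʳ-≤ (compFact β) (maxCoeff-*ₚ-≤ q Pα) ⟩
  compFact β * (sum q * maxCoeff Pα)  ≡⟨ sym (*-assoc (compFact β) (sum q) _) ⟩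
  compFact β * sum q * maxCoeff Pα    ≡⟨ cong (_* maxCoeff Pα) (trans (*-comm (compFact β) _) q[1]*β!≡α!) ⟩
  compFact α * maxCoeff Pα ∎
  where
  open ≤-Reasoning
  Pβ≃qPα : Pβ ≃ (q *ₚ Pα)
  Pβ≃qPα = qMultinomial-quotient n α β Pα Pβ q hα hβ α≃qβ
  q[1]*β!≡α! : sum q * compFact β ≡ compFact α
  q[1]*β!≡α! = compFact-quotient α β q α≃qβ
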